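{- Let $k$ be a positive integer and let $\mathcal{H}$ be a connected hypergraph with strict hypertree depth at most $k$. Then for no $n\ge 2^k$ is there a hypergraph homomorphism $(h_V,h_E)$ from $\mathcal{H}$ to $\mathcal{P}_n$ with both $h_V$ and $h_E$ surjective.
   Context: A hypergraph is $(V,E,\beta)$ with disjoint finite $V,E$ and total $\beta\colon E\to\mathcal{P}(V)$ with $V=\bigcup_e\beta(e)$; it is connected if its incidence graph (bipartite graph on $V\cup E$ with $e$ adjacent to $v$ iff $v\in\beta(e)$) is connected. $\mathcal{P}_n$ is the hypergraph with vertices $\{1,\dots,n+1\}$, hyperedges $e_1,\dots,e_n$ and $\beta(e_i)=\{i,i+1\}$. A homomorphism $\mathcal{F}\to\mathcal{G}$ is a pair $(h_V,h_E)$ of maps on vertices and hyperedges with $h_V(\beta_{\mathcal{F}}(e))=\beta_{\mathcal{G}}(h_E(e))$ for all hyperedges $e$. Strict hypertree depth: for a rooted forest $F$, $\le_F$ is the tree order (roots minimal), $P(s)$ the nodes on the path from $s$ to its root, $\mathrm{lcv}(s,t)$ the $\le_F$-maximum of $P(s)\cap P(t)$ (defined iff same tree), height the maximum of $|P(s)|$. A strict elimination forest of $\mathcal{H}$ is $(F,\Gamma)$ with $\Gamma\colon V(F)\to E(\mathcal{H})$ bijective such that, with $\hat\Gamma(t)=\beta(\Gamma(t))$, whenever $\hat\Gamma(s)\cap\hat\Gamma(t)\ne\emptyset$, $\mathrm{lcv}(s,t)$ is defined and $\hat\Gamma(s)\cap\hat\Gamma(t)\subseteq\bigcup_{p\in P(\mathrm{lcv}(s,t))}\hat\Gamma(p)$;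 $\mathrm{shd}(\mathcal{H})$ is the minimum height of such a forest. -}

module Defs where

open import Data.Nat using (ℕ; zero; suc; _≤_; _<_)
open import Data.Fin using (Fin; inject₁) renaming (suc to fsuc)
open import Data.Fin.Subset using (Subset; _∈_; ⁅_⁆; _∪_)
open import Data.Maybe using (Maybe; just; nothing)
open import Data.Sum using (_⊎_; inj₁; inj₂)
open import Data.Product using (Σ; ∃; _×_; _,_)
open import Relation.Binary.PropositionalEquality using (_≡_)
open import Relation.Binary.Construct.Closure.ReflexiveTransitive using (Star)
open import Function.Definitions using (Bijective; Surjective)

-- Hypergraphs (V,E,β): V = Fin nV, E = Fin nE (disjoint by construction),
-- β : E → 𝒫(V) total.  The condition V = ⋃ β(e) is the predicate Covers.

record Hypergraph : Set where
  field
    nV : ℕ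
    nE : ℕ
    β  : Fin nE → Subset nV

open Hypergraph public

Covers : Hypergraph → Set
Covers H = (v : Fin (nV H)) → ∃ λ e → v ∈ β H e

data IncAdj (H : Hypergraph) : Fin (nV H) ⊎ Fin (nE H) → Fin (nV H) ⊎ Fin (nE H) → Set where
  v→e : ∀ {v e} → v ∈ β H e → IncAdj H (inj₁ v) (inj₂ e)
  e→v : ∀ {v e} → v ∈ β H e → IncAdj H (inj₂ e) (inj₁ v)

Connected : Hypergraph → Set
Connected H = ∀ x y → Star (IncAdj H) x y

-- The path hypergraph 𝒫ₙ: vertices 1..n+1 (as Fin (suc n), i ↦ i-1),
-- hyperedges e₁..eₙ (as Fin n), β(eᵢ) = {i, i+1}.
𝒫 : ℕ → Hypergraph
𝒫 n = record
  { nV = suc n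
  ; nE = n
  ; β = λ i → ⁅ inject₁ i ⁆ ∪ ⁅ fsuc i ⁆
  }

-- Homomorphisms: h_V(β_F(e)) = β_G(h_E(e)) for every hyperedge e.

IsHom : (F G : Hypergraph) → (Fin (nV F) → Fin (nV G)) → (Fin (nE F) → Fin (nE G)) → Set
IsHom F G hV hE =
  (e : Fin (nE F)) →
    ((v : Fin (nV F)) → v ∈ β F e → hV v ∈ β G (hE e))
    × ((w : Fin (nV G)) → w ∈ β G (hE e) → ∃ λ v → v ∈ β F e × hV v ≡ w)

-- Rooted forests on the node set Fin m: each node has at most one parent
-- (nothing = root); acyclicity is witnessed by a rank function that
-- strictly decreases towards the parent.

record RootedForest (m : ℕ) : Set where
  field
    parent   : Fin m → Maybe (Fin m)
    rank     : Fin m → ℕ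
    rank-dec : ∀ {s p} → parent s ≡ just p → rank p < rank s

open RootedForest public

-- InP F s t : t ∈ P(s), i.e. t lies on the path from s to its root
-- (equivalently t ≤_F s).
data InP {m : ℕ} (F : RootedForest m) : Fin m → Fin m → Set where
  here  : ∀ {s} → InP F s s
  there : ∀ {s p t} → parent F s ≡ just p → InP F p t → InP F s t

data PathSize {m : ℕ} (F : RootedForest m) : Fin m → ℕ → Set where
  root : ∀ {s} → parent F s ≡ nothing → PathSize F s 1
  step : ∀ {s p l} → parent F s ≡ just p → PathSize F p l → PathSize F s (suc l)

HeightAtMost : {m : ℕ} → RootedForest m → ℕ → Set
HeightAtMost F k = ∀ s l → PathSize F s l → l ≤ k

IsLcv : {m : ℕ} → RootedForest m → Fin m → Fin m → Fin m → Set
IsLcv F s t u = InP F s u × InP F t u × (∀ w → InP F s w → InP F t w → InP F u w)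

record StrictElimForest (H : Hypergraph) : Set where
  field
    m       : ℕ
    forest  : RootedForest m
    Γ       : Fin m → Fin (nE H)
    Γ-bij   : Bijective _≡_ _≡_ Γ
    strict  : ∀ s t →
              (∃ λ v → v ∈ β H (Γ s) × v ∈ β H (Γ t)) →
              ∃ λ u → IsLcv forest s t u ×
                ((v : Fin (nV H)) → v ∈ β H (Γ s) → v ∈ β H (Γ t) →
                  ∃ λ p → InP forest u p × v ∈ β H (Γ p))

open StrictElimForest public

ShdAtMost : Hypergraph → ℕ → Set
ShdAtMost H k = ∃ λ (T : StrictElimForest H) → HeightAtMost (forest T) k

module Submission where

open import Defs
open import Data.Nat using (ℕ; zero; suc; _+_; _^_; _≤_; _<_; ∣_-_∣; z≤n; s≤s)
open import Data.Nat.Properties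
open import Data.Fin using (Fin; toℕ; inject₁; fromℕ) renaming (zero to fzero; suc to fsuc)
open import Data.Fin.Properties using (toℕ-inject₁; toℕ-fromℕ)
open import Data.Fin.Subset using (Subset; _∈_; _∉_; ⁅_⁆)
open import Data.Fin.Subset.Properties using (x∈p∪q⁻; x∈⁅y⁆⇒x≡y; _∈?_)
open import Data.Maybe using (just; nothing)
open import Data.Product using (∃; _×_; _,_; proj₁; proj₂)
open import Data.Sum as Sum using (_⊎_; inj₁; inj₂)
open import Data.Empty using (⊥-elim)
open import Function using (_∘_)
open import Function.Definitions using (Surjective)
open import Relation.Nullary using (¬_; yes; no)
open import Relation.Binary.PropositionalEquality using (_≡_; refl; sym; trans; cong; subst; subst₂)
open import Relation.Binary.Construct.Closure.ReflexiveTransitive using (Star; ε; _◅_; reverse)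

-- Fix a strict elimination forest of height k and a map f from
-- the vertices to ℕ that moves vertices sharing a hyperedge by at most 1.
-- Call two bags linked below a node u if they share a vertex occurring in no
-- bag strictly above u; strictness forces such links to stay inside the
-- subtree of u.  Inside a subtree with h levels, linked bags carry vertices
-- whose f-values differ by less than 2^h: a chain of links either stays in
-- the subtree of one child of u, or meets the bag of u itself, whose vertices
-- lie within distance 1, giving (2^(h-1) - 1) + 1 + (2^(h-1) - 1).
-- At a root of a connected hypergraph every two bags are linked, so f has
-- spread below 2^k; a surjective homomorphism onto 𝒫ₙ has spread n.

module _ {m : ℕ} {F : RootedForest m} where

  InP-trans : ∀ {s a b} → InP F s a → InP F a b → InP F s b
  InP-trans here         q = q
  InP-trans (there ps r) q = there ps (InP-trans r q)

  InP-total : ∀ {s a b} → InP F s a → InP F s b → InP F a b ⊎ InP F b a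
  InP-total here         q              = inj₁ q
  InP-total (there ps r) here           = inj₂ (there ps r)
  InP-total (there ps r) (there ps′ r′) with trans (sym ps) ps′
  ... | refl = InP-total r r′

  InP-child : ∀ {s u} → InP F s u → s ≡ u ⊎ ∃ λ c → parent F c ≡ just u × InP F s c
  InP-child here = inj₁ refl
  InP-child {s} (there ps r) with InP-child r
  ... | inj₁ refl           = inj₂ (s , ps , here)
  ... | inj₂ (c , pc , sc) = inj₂ (c , pc , there ps sc)

  InP-root : ∀ s → ∃ λ r → parent F r ≡ nothing × InP F s r
  InP-root s = go (suc (rank F s)) s ≤-refl
    where
    go : ∀ fuel s → rank F s < fuel → ∃ λ r → parent F r ≡ nothing × InP F s r
    go (suc fuel) s (s≤s lt) with parent F s in eq
    ... | nothing = s , eq , here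
    ... | just p with go fuel p (<-≤-trans (rank-dec F eq) lt)
    ...   | r , pr , pr′ = r , pr , there eq pr′

module Links {H : Hypergraph} (T : StrictElimForest H) where

  private
    F = forest T

  bag : Fin (m T) → Subset (nV H)
  bag s = β H (Γ T s)

  InBagAbove : Fin (m T) → Fin (nV H) → Set
  InBagAbove u w = ∃ λ a → parent F u ≡ just a × ∃ λ p → InP F a p × w ∈ bag p

  Link : Fin (m T) → Fin (m T) → Fin (m T) → Set
  Link u s t = ∃ λ w → w ∈ bag s × w ∈ bag t × ¬ InBagAbove u w

  Walk : Fin (m T) → Fin (m T) → Fin (m T) → Set
  Walk u = Star (Link u)

  Walk-reverse : ∀ {u s t} → Walk u s t → Walk u t s
  Walk-reverse = reverse λ (w , ws , wt , w∉) → w , wt , ws , w∉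

  Link-stays-below : ∀ {u s t} → InP F s u → Link u s t → InP F t u
  Link-stays-below {u} {s} {t} su (w , ws , wt , w∉) with strict T s t (w , ws , wt)
  ... | l , (sl , tl , _) , cover with cover w ws wt | InP-total sl su
  ... | _ | inj₁ lu                      = InP-trans tl lu
  ... | _ | inj₂ here                    = tl
  ... | p , lp , wp | inj₂ (there ua al) = ⊥-elim (w∉ (_ , ua , p , InP-trans al lp , wp))

  Walk-stays-below : ∀ {u s t} → InP F s u → Walk u s t → InP F t u
  Walk-stays-below su ε          = su
  Walk-stays-below su (st ◅ wk) = Walk-stays-below (Link-stays-below su st) wk

  ¬InBagAbove-child : ∀ {c u w} → parent F c ≡ just u → w ∉ bag u →
                      ¬ InBagAbove u w → ¬ InBagAbove c w
  ¬InBagAbove-child cu w∉u w∉ (a , ca , p , ap , wp) with trans (sym cu) ca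
  ... | refl with ap
  ... | here           = w∉u wp
  ... | there ua a′p   = w∉ (_ , ua , p , a′p , wp)

  ¬InBagAbove-root : ∀ {r w} → parent F r ≡ nothing → ¬ InBagAbove r w
  ¬InBagAbove-root r-root (a , ra , _) with trans (sym r-root) ra
  ... | ()

  Walk-descend : ∀ {c u s t} → parent F c ≡ just u → InP F s c → Walk u s t →
                 Walk c s t ⊎ ∃ λ r → ∃ λ w → Walk c s r × w ∈ bag r × w ∈ bag u
  Walk-descend cu sc ε = inj₁ ε
  Walk-descend {u = u} {s} cu sc ((w , ws , wt , w∉) ◅ wk) with w ∈? bag u
  ... | yes wu = inj₂ (s , w , ε , ws , wu)
  ... | no w∉u = Sum.map (st ◅_) (λ (r , w′ , wk′ , rest) → r , w′ , st ◅ wk′ , rest)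
                   (Walk-descend cu (Link-stays-below sc st) wk)
    where st = w , ws , wt , ¬InBagAbove-child cu w∉u w∉

  node : Fin (nE H) → Fin (m T)
  node e = proj₁ (proj₂ (Γ-bij T) e)

  ∈-bag-node : ∀ {v e} → v ∈ β H e → v ∈ bag (node e)
  ∈-bag-node {v} {e} ve = subst (λ e′ → v ∈ β H e′) (sym (proj₂ (proj₂ (Γ-bij T) e) refl)) ve

  incidence-path⇒Walk : ∀ {r e e′} → parent F r ≡ nothing →
                        Star (IncAdj H) (inj₂ e) (inj₂ e′) → Walk r (node e) (node e′)
  incidence-path⇒Walk r-root ε = ε
  incidence-path⇒Walk r-root (e→v ve ◅ v→e ve′ ◅ path) =
    (_ , ∈-bag-node ve , ∈-bag-node ve′ , ¬InBagAbove-root r-root) ◅ incidence-path⇒Walk r-root path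

Lipschitz : (H : Hypergraph) → (Fin (nV H) → ℕ) → Set
Lipschitz H f = ∀ e {x y} → x ∈ β H e → y ∈ β H e → ∣ f x - f y ∣ ≤ 1

∣n-n∣≤1 : ∀ n → ∣ n - n ∣ ≤ 1
∣n-n∣≤1 n = subst (_≤ 1) (sym (∣n-n∣≡0 n)) z≤n

∣n-1+n∣≡1 : ∀ n → ∣ n - suc n ∣ ≡ 1
∣n-1+n∣≡1 zero    = refl
∣n-1+n∣≡1 (suc n) = ∣n-1+n∣≡1 n

∈-𝒫-edge : ∀ {n} (i : Fin n) {a} → a ∈ β (𝒫 n) i → toℕ a ≡ toℕ i ⊎ toℕ a ≡ suc (toℕ i)
∈-𝒫-edge i a∈ with x∈p∪q⁻ ⁅ inject₁ i ⁆ ⁅ fsuc i ⁆ a∈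
... | inj₁ a∈₁ = inj₁ (trans (cong toℕ (x∈⁅y⁆⇒x≡y _ a∈₁)) (toℕ-inject₁ i))
... | inj₂ a∈₂ = inj₂ (cong toℕ (x∈⁅y⁆⇒x≡y _ a∈₂))

𝒫-Lipschitz : ∀ n → Lipschitz (𝒫 n) toℕ
𝒫-Lipschitz n i a∈ b∈ with ∈-𝒫-edge i a∈ | ∈-𝒫-edge i b∈
... | inj₁ a≡ | inj₁ b≡ rewrite a≡ | b≡ = ∣n-n∣≤1 (toℕ i)
... | inj₁ a≡ | inj₂ b≡ rewrite a≡ | b≡ = ≤-reflexive (∣n-1+n∣≡1 (toℕ i))
... | inj₂ a≡ | inj₁ b≡ rewrite a≡ | b≡ = ≤-reflexive (trans (∣-∣-comm (suc (toℕ i)) (toℕ i)) (∣n-1+n∣≡1 (toℕ i)))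
... | inj₂ a≡ | inj₂ b≡ rewrite a≡ | b≡ = ∣n-n∣≤1 (suc (toℕ i))

hom-Lipschitz : ∀ {F G hV hE f} → IsHom F G hV hE → Lipschitz G f → Lipschitz F (f ∘ hV)
hom-Lipschitz hom f-lip e x∈ y∈ = f-lip _ (proj₁ (hom e) _ x∈) (proj₁ (hom e) _ y∈)

+-+-<-2^suc : ∀ {a b c} h → a < 2 ^ h → b ≤ 1 → c < 2 ^ h → a + (b + c) < 2 ^ suc h
+-+-<-2^suc {a} {b} {c} h a< b≤1 c< = begin-strict
  a + (b + c)     ≤⟨ +-monoʳ-≤ a (+-monoˡ-≤ c b≤1) ⟩
  a + suc c       <⟨ +-mono-≤ a< c< ⟩
  2 ^ h + 2 ^ h   ≡⟨ cong (2 ^ h +_) (sym (+-identityʳ (2 ^ h))) ⟩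
  2 ^ suc h       ∎
  where open ≤-Reasoning

module Spread {H : Hypergraph} (T : StrictElimForest H) {k : ℕ}
              (height : HeightAtMost (forest T) k)
              (f : Fin (nV H) → ℕ) (f-lip : Lipschitz H f) where

  open Links T
  private
    F = forest T

  dist : Fin (nV H) → Fin (nV H) → ℕ
  dist x y = ∣ f x - f y ∣

  dist-triangle₃ : ∀ x w₁ w₂ y → dist x y ≤ dist x w₁ + (dist w₁ w₂ + dist w₂ y)
  dist-triangle₃ x w₁ w₂ y = ≤-trans (∣-∣-triangle (f x) (f w₁) (f y))
    (+-monoʳ-≤ (dist x w₁) (∣-∣-triangle (f w₁) (f w₂) (f y)))

  -- k < d + h says that the subtree of u, at depth d, has at most h levels.
  Walk-dist< : ∀ h {u d} → PathSize F u d → k < d + h → ∀ {s t} → InP F s u → Walk u s t →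
               ∀ {x y} → x ∈ bag s → y ∈ bag t → dist x y < 2 ^ h
  Walk-near-end⊎near-bag :
    ∀ h {u d} → PathSize F u d → k < d + suc h → ∀ {s t} → InP F s u → Walk u s t →
    ∀ {x} → x ∈ bag s →
    (∀ {y} → y ∈ bag t → dist x y < 2 ^ h) ⊎ ∃ λ w → w ∈ bag u × dist x w < 2 ^ h

  Walk-dist< zero {u} {d} du k<d+0 _ _ _ _ =
    ⊥-elim (<⇒≱ (subst (k <_) (+-identityʳ d) k<d+0) (height u d du))
  Walk-dist< (suc h) du k< su wk {x} {y} xs yt
    with Walk-near-end⊎near-bag h du k< su wk xs
  ... | inj₁ near-y = ≤-trans (near-y yt) (m≤m+n (2 ^ h) _)
  ... | inj₂ (w₁ , w₁u , x-w₁)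
    with Walk-near-end⊎near-bag h du k< (Walk-stays-below su wk) (Walk-reverse wk) yt
  ...   | inj₁ near-x = ≤-trans (subst (_< 2 ^ h) (∣-∣-comm (f y) (f x)) (near-x xs)) (m≤m+n (2 ^ h) _)
  ...   | inj₂ (w₂ , w₂u , y-w₂) = ≤-<-trans (dist-triangle₃ x w₁ w₂ y)
    (+-+-<-2^suc h x-w₁ (f-lip (Γ T _) w₁u w₂u) (subst (_< 2 ^ h) (∣-∣-comm (f y) (f w₂)) y-w₂))

  Walk-near-end⊎near-bag h {u} {d} du k< su wk {x} xs with InP-child su
  ... | inj₁ refl = inj₂ (x , xs , subst (_< 2 ^ h) (sym (∣n-n∣≡0 (f x))) (m^n>0 2 h))
  ... | inj₂ (c , cu , sc) =
    Sum.map (λ wk′ yt → Walk-dist< h (step cu du) k<′ sc wk′ xs yt)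
            (λ (r , w , wk′ , wr , wu) → w , wu , Walk-dist< h (step cu du) k<′ sc wk′ xs wr)
            (Walk-descend cu sc wk)
    where k<′ = subst (k <_) (+-suc d h) k<

  connected⇒dist< : Connected H → ∀ {e e′ x y} → x ∈ β H e → y ∈ β H e′ → dist x y < 2 ^ k
  connected⇒dist< connected {e} {e′} xe ye′ with InP-root (node e)
  ... | r , r-root , er =
    Walk-dist< k (root r-root) ≤-refl er (incidence-path⇒Walk r-root (connected (inj₂ e) (inj₂ e′)))
               (∈-bag-node xe) (∈-bag-node ye′)

lemmaB2 : (k : ℕ) → 1 ≤ k → (H : Hypergraph) → Covers H → Connected H → ShdAtMost H k →
    (n : ℕ) → 2 ^ k ≤ n →
    ¬ (∃ λ (hV : Fin (nV H) → Fin (nV (𝒫 n))) → ∃ λ (hE : Fin (nE H) → Fin (nE (𝒫 n))) →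
         IsHom H (𝒫 n) hV hE × Surjective _≡_ _≡_ hV × Surjective _≡_ _≡_ hE)
lemmaB2 k _ H covers connected (T , height) n 2^k≤n (hV , hE , hom , hV-onto , _) =
  <⇒≱ n<2^k 2^k≤n
  where
  open Spread T height (toℕ ∘ hV) (hom-Lipschitz {f = toℕ} hom (𝒫-Lipschitz n))
  first last : Fin (nV H)
  first = proj₁ (hV-onto fzero)
  last  = proj₁ (hV-onto (fromℕ n))
  n<2^k : n < 2 ^ k
  n<2^k = subst₂ (λ a b → ∣ a - b ∣ < 2 ^ k)
            (cong toℕ (proj₂ (hV-onto fzero) refl))
            (trans (cong toℕ (proj₂ (hV-onto (fromℕ n)) refl)) (toℕ-fromℕ n))
            (connected⇒dist< connected (proj₂ (covers first)) (proj₂ (covers last)))
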